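{- Let $\left(\frac{r}{q}, \frac{s}{q}\right)$ be a torsion point of $\mathbb{R}^2/\mathbb{Z}^2$, where $r,s,q$ are integers with $q>0$ and $\gcd(r,s,q)=1$, and let $Q \ge 1$. Then the distance, measured by the metric on $\mathbb{R}^2/\mathbb{Z}^2$ induced by the Euclidean metric, from $\left(\frac{r}{q}, \frac{s}{q}\right)$ to any different torsion point $\left(\frac{r_1}{q_1}, \frac{s_1}{q_1}\right)$ (with $q_1>0$, $\gcd(r_1,s_1,q_1)=1$) of torsion $q_1 \le Q$ is at least $$\frac{1}{qQ} \min \left\{ \sqrt{A^2 + B^2} \ :\ (A,B) \in \mathbb{Z}^2 \setminus\{(0,0)\},\ A\frac{r}{q} + B\frac{s}{q} \in \mathbb{Z} \right\}.$$
   Context: A torsion point of $\mathbb{R}^2/\mathbb{Z}^2$ is a point of finite order; writing it as $\left(\frac{r}{q},\frac{s}{q}\right)$ with $q>0$ and $\gcd(r,s,q)=1$, its torsion is $q$.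
   Formalization: The parameter $Q \ge 1$ bounding the torsion of the second point is taken to be rational. -}

module Defs where

open import Data.Nat as ℕ using (ℕ)
open import Data.Integer as ℤ using (ℤ; +_)
open import Data.Integer.GCD as ℤG using ()
open import Data.Rational as ℚ using (ℚ; _/_; _+_; _-_; _*_; _≤_)
open import Data.Product using (Σ; _×_; ∃; ∃-syntax)
open import Relation.Binary.PropositionalEquality using (_≡_)
open import Relation.Nullary using (¬_)

ι : ℤ → ℚ
ι z = z / 1

sq : ℚ → ℚ
sq x = x * x

Primitive : ℤ → ℤ → ℤ → Set
Primitive r s q = ℤG.gcd (ℤG.gcd r s) q ≡ + 1

SameTorusPoint : ℚ → ℚ → ℚ → ℚ → Set
SameTorusPoint x y x' y' = ∃[ m ] ∃[ n ] ((x' - x ≡ ι m) × (y' - y ≡ ι n))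

-- c ≤ dist((x,y),(x',y'))² · K, where the squared torus distance is
-- the infimum over integer translates (m,n) of (x'-x-m)²+(y'-y-n)²
ScaledTorusDistSqAtLeast : ℚ → ℚ → ℚ → ℚ → ℚ → ℚ → Set
ScaledTorusDistSqAtLeast x y x' y' K c =
  ∀ (m n : ℤ) → c ≤ (sq (x' - x - ι m) + sq (y' - y - ι n)) * K

Admissible : ℚ → ℚ → ℤ → ℤ → Set
Admissible x y A B = ¬ (A ≡ + 0 × B ≡ + 0) × (∃[ k ] (ι A * x + ι B * y ≡ ι k))

-- M is the minimum of A²+B² over admissible (A,B)
-- (i.e. sqrt M is the minimum of sqrt(A²+B²))
IsMinAdmissibleNormSq : ℚ → ℚ → ℤ → Set
IsMinAdmissibleNormSq x y M =
  (∃[ A ] ∃[ B ] (Admissible x y A B × M ≡ A ℤ.* A ℤ.+ B ℤ.* B))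
  × (∀ A B → Admissible x y A B → M ℤ.≤ A ℤ.* A ℤ.+ B ℤ.* B)

{-# OPTIONS --safe #-}
module Submission where

open import Defs
open import Data.Nat as ℕ using (ℕ; NonZero; suc)
open import Data.Integer as ℤ using (ℤ; +_)
open import Data.Integer.Solver using (module +-*-Solver)
open import Data.Rational as ℚ using (ℚ; fromℚᵘ; _/_; _*_; _≤_; _+_; _-_; -_; 0ℚ; 1ℚ)
import Data.Rational.Properties as ℚP
import Data.Rational.Solver as QS
open import Data.Rational.Unnormalised as ℚᵘ using (ℚᵘ; mkℚᵘ; *≡*; *≤*)
import Data.Rational.Unnormalised.Properties as ℚᵘP
import Data.Integer.Properties as ℤP
import Data.Nat.Properties as ℕP
open import Data.Product using (_,_; _×_)
open import Data.Sum using (inj₁; inj₂)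
open import Relation.Nullary using (¬_)
open import Relation.Binary.PropositionalEquality

-- Clearing denominators, a = q q₁ (r₁/q₁ - r/q - m) and b = q q₁ (s₁/q₁ - s/q - n)
-- are integers, not both zero because the points differ. The vector (b, -a) is
-- admissible for (r/q, s/q): in b r - a s the terms in q₁ r s cancel, so it is
-- divisible by q. Hence M ≤ a² + b² = (q q₁)² ((r₁/q₁ - r/q - m)² + (s₁/q₁ - s/q - n)²),
-- and q₁ ≤ Q finishes the bound.

fromℚᵘ-homo-+ : ∀ p q → fromℚᵘ (p ℚᵘ.+ q) ≡ fromℚᵘ p + fromℚᵘ q
fromℚᵘ-homo-+ p q = ℚP.toℚᵘ-injective (ℚᵘP.≃-trans (ℚP.toℚᵘ-fromℚᵘ (p ℚᵘ.+ q)) (ℚᵘP.≃-sym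
  (ℚᵘP.≃-trans (ℚP.toℚᵘ-homo-+ (fromℚᵘ p) (fromℚᵘ q)) (ℚᵘP.+-cong (ℚP.toℚᵘ-fromℚᵘ p) (ℚP.toℚᵘ-fromℚᵘ q)))))

fromℚᵘ-homo-* : ∀ p q → fromℚᵘ (p ℚᵘ.* q) ≡ fromℚᵘ p * fromℚᵘ q
fromℚᵘ-homo-* p q = ℚP.toℚᵘ-injective (ℚᵘP.≃-trans (ℚP.toℚᵘ-fromℚᵘ (p ℚᵘ.* q)) (ℚᵘP.≃-sym
  (ℚᵘP.≃-trans (ℚP.toℚᵘ-homo-* (fromℚᵘ p) (fromℚᵘ q)) (ℚᵘP.*-cong (ℚP.toℚᵘ-fromℚᵘ p) (ℚP.toℚᵘ-fromℚᵘ q)))))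

fromℚᵘ-homo‿- : ∀ p → fromℚᵘ (ℚᵘ.- p) ≡ - fromℚᵘ p
fromℚᵘ-homo‿- p = ℚP.toℚᵘ-injective (ℚᵘP.≃-trans (ℚP.toℚᵘ-fromℚᵘ (ℚᵘ.- p)) (ℚᵘP.≃-sym
  (ℚᵘP.≃-trans (ℚP.toℚᵘ-homo‿- (fromℚᵘ p)) (ℚᵘP.-‿cong (ℚP.toℚᵘ-fromℚᵘ p)))))

fromℚᵘ-mono-≤ : ∀ {p q} → p ℚᵘ.≤ q → fromℚᵘ p ≤ fromℚᵘ q
fromℚᵘ-mono-≤ {p} {q} p≤q = ℚP.toℚᵘ-cancel-≤
  (ℚᵘP.≤-respˡ-≃ (ℚᵘP.≃-sym (ℚP.toℚᵘ-fromℚᵘ p)) (ℚᵘP.≤-respʳ-≃ (ℚᵘP.≃-sym (ℚP.toℚᵘ-fromℚᵘ q)) p≤q))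

-- ι z and r / suc k are definitionally fromℚᵘ (mkℚᵘ z 0) and fromℚᵘ (mkℚᵘ r k).
ιᵘ : ℤ → ℚᵘ
ιᵘ z = mkℚᵘ z 0

ι-+ : ∀ a b → ι (a ℤ.+ b) ≡ ι a + ι b
ι-+ a b = trans (ℚP.fromℚᵘ-cong {ιᵘ (a ℤ.+ b)} {ιᵘ a ℚᵘ.+ ιᵘ b} (*≡* (solve 2
    (λ a b → (a :+ b) :* con (+ 1) := (a :* con (+ 1) :+ b :* con (+ 1)) :* con (+ 1)) refl a b)))
  (fromℚᵘ-homo-+ (ιᵘ a) (ιᵘ b))
  where open +-*-Solver

ι-* : ∀ a b → ι (a ℤ.* b) ≡ ι a * ι b
ι-* a b = fromℚᵘ-homo-* (ιᵘ a) (ιᵘ b)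

ι-neg : ∀ a → ι (ℤ.- a) ≡ - ι a
ι-neg a = fromℚᵘ-homo‿- (ιᵘ a)

ι-- : ∀ a b → ι (a ℤ.- b) ≡ ι a - ι b
ι-- a b = trans (ι-+ a (ℤ.- b)) (cong (_+_ (ι a)) (ι-neg b))

ι-sumOfSquares : ∀ A B → ι (A ℤ.* A ℤ.+ B ℤ.* B) ≡ ι A * ι A + ι B * ι B
ι-sumOfSquares A B = trans (ι-+ (A ℤ.* A) (B ℤ.* B)) (cong₂ _+_ (ι-* A A) (ι-* B B))

ι-mono-≤ : ∀ {a b} → a ℤ.≤ b → ι a ≤ ι b
ι-mono-≤ {a} {b} a≤b = fromℚᵘ-mono-≤ {ιᵘ a} {ιᵘ b} (*≤* (ℤP.*-monoʳ-≤-nonNeg (+ 1) a≤b))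

ι-pos : ∀ q .{{_ : NonZero q}} → ℚ.Positive (ι (+ q))
ι-pos (suc k) = ℚP.normalize-pos (suc k) 1

ι-*-/ : ∀ r q .{{_ : NonZero q}} → ι (+ q) * (r / q) ≡ ι r
ι-*-/ r (suc k) = trans (sym (fromℚᵘ-homo-* (ιᵘ (+ suc k)) (mkℚᵘ r k)))
  (ℚP.fromℚᵘ-cong {ιᵘ (+ suc k) ℚᵘ.* mkℚᵘ r k} {ιᵘ r} (*≡* (trans
    (solve 2 (λ q r → (q :* r) :* con (+ 1) := r :* q) refl (+ suc k) r)
    (cong (λ d → r ℤ.* + suc d) (sym (ℕP.+-identityʳ k))))))
  where open +-*-Solver

*-cancelˡ-≡-pos : ∀ c .{{_ : ℚ.Positive c}} {x y} → c * x ≡ c * y → x ≡ y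
*-cancelˡ-≡-pos c cx≡cy = ℚP.≤-antisym
  (ℚP.*-cancelˡ-≤-pos c (ℚP.≤-reflexive cx≡cy)) (ℚP.*-cancelˡ-≤-pos c (ℚP.≤-reflexive (sym cx≡cy)))

0≤p*p : ∀ p → 0ℚ ≤ p * p
0≤p*p p with ℚP.≤-total 0ℚ p
... | inj₁ 0≤p = ℚP.nonNegative⁻¹ (p * p) {{ℚP.nonNeg*nonNeg⇒nonNeg p {{ℚ.nonNegative 0≤p}} p {{ℚ.nonNegative 0≤p}}}}
... | inj₂ p≤0 = ℚP.nonNegative⁻¹ (p * p) {{ℚP.nonPos*nonPos⇒nonPos p {{ℚ.nonPositive p≤0}} p {{ℚ.nonPositive p≤0}}}}

*-mono-≤-square : ∀ {p q} → 0ℚ ≤ p → p ≤ q → p * p ≤ q * q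
*-mono-≤-square {p} {q} 0≤p p≤q = ℚP.≤-trans (ℚP.*-monoˡ-≤-nonNeg p {{ℚ.nonNegative 0≤p}} p≤q)
  (ℚP.*-monoʳ-≤-nonNeg q {{ℚ.nonNegative (ℚP.≤-trans 0≤p p≤q)}} p≤q)

crossNumerator : ℤ → ℕ → ℤ → ℕ → ℤ → ℤ
crossNumerator r q r₁ q₁ m = + q ℤ.* r₁ ℤ.- + q₁ ℤ.* r ℤ.- + q ℤ.* + q₁ ℤ.* m

ι-crossNumerator : ∀ r q r₁ q₁ .{{_ : NonZero q}} .{{_ : NonZero q₁}} m →
  ι (crossNumerator r q r₁ q₁ m) ≡ ι (+ q) * ι (+ q₁) * (r₁ / q₁ - r / q - ι m)
ι-crossNumerator r q r₁ q₁ m = begin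
  ι (+ q ℤ.* r₁ ℤ.- + q₁ ℤ.* r ℤ.- + q ℤ.* + q₁ ℤ.* m)
    ≡⟨ trans (ι-- (+ q ℤ.* r₁ ℤ.- + q₁ ℤ.* r) (+ q ℤ.* + q₁ ℤ.* m))
         (cong₂ _-_ (ι-- (+ q ℤ.* r₁) (+ q₁ ℤ.* r)) (ι-* (+ q ℤ.* + q₁) m)) ⟩
  ι (+ q ℤ.* r₁) - ι (+ q₁ ℤ.* r) - ι (+ q ℤ.* + q₁) * ι m
    ≡⟨ cong₂ (λ u v → u - v - ι (+ q ℤ.* + q₁) * ι m) (ι-* (+ q) r₁) (ι-* (+ q₁) r) ⟩
  ι (+ q) * ι r₁ - ι (+ q₁) * ι r - ι (+ q ℤ.* + q₁) * ι m
    ≡⟨ cong₂ (λ u v → ι (+ q) * u - ι (+ q₁) * v - ι (+ q ℤ.* + q₁) * ι m)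
         (sym (ι-*-/ r₁ q₁)) (sym (ι-*-/ r q)) ⟩
  ι (+ q) * (ι (+ q₁) * (r₁ / q₁)) - ι (+ q₁) * (ι (+ q) * (r / q)) - ι (+ q ℤ.* + q₁) * ι m
    ≡⟨ cong (λ c → ι (+ q) * (ι (+ q₁) * (r₁ / q₁)) - ι (+ q₁) * (ι (+ q) * (r / q)) - c * ι m)
         (ι-* (+ q) (+ q₁)) ⟩
  ι (+ q) * (ι (+ q₁) * (r₁ / q₁)) - ι (+ q₁) * (ι (+ q) * (r / q)) - ι (+ q) * ι (+ q₁) * ι m
    ≡⟨ solve 5 (λ c c₁ x₁ x w → c :* (c₁ :* x₁) :- c₁ :* (c :* x) :- c :* c₁ :* w := c :* c₁ :* (x₁ :- x :- w))
         refl (ι (+ q)) (ι (+ q₁)) (r₁ / q₁) (r / q) (ι m) ⟩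
  ι (+ q) * ι (+ q₁) * (r₁ / q₁ - r / q - ι m) ∎
  where
  open ≡-Reasoning
  open QS.+-*-Solver

crossNumerator≡0⇒r₁/q₁-r/q≡m : ∀ r q r₁ q₁ .{{_ : NonZero q}} .{{_ : NonZero q₁}} m →
  crossNumerator r q r₁ q₁ m ≡ + 0 → r₁ / q₁ - r / q ≡ ι m
crossNumerator≡0⇒r₁/q₁-r/q≡m r q r₁ q₁ m a≡0 = begin
  r₁ / q₁ - r / q
    ≡⟨ solve 3 (λ u v w → u :- v := (u :- v :- w) :+ w) refl (r₁ / q₁) (r / q) (ι m) ⟩
  (r₁ / q₁ - r / q - ι m) + ι m        ≡⟨ cong (_+ ι m) d≡0 ⟩
  0ℚ + ι m                             ≡⟨ ℚP.+-identityˡ (ι m) ⟩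
  ι m                                  ∎
  where
  open ≡-Reasoning
  open QS.+-*-Solver
  instance
    C>0 : ℚ.Positive (ι (+ q) * ι (+ q₁))
    C>0 = ℚP.pos*pos⇒pos (ι (+ q)) {{ι-pos q}} (ι (+ q₁)) {{ι-pos q₁}}
  d≡0 : r₁ / q₁ - r / q - ι m ≡ 0ℚ
  d≡0 = *-cancelˡ-≡-pos (ι (+ q) * ι (+ q₁)) (begin
    ι (+ q) * ι (+ q₁) * (r₁ / q₁ - r / q - ι m) ≡⟨ sym (ι-crossNumerator r q r₁ q₁ m) ⟩
    ι (crossNumerator r q r₁ q₁ m)               ≡⟨ cong ι a≡0 ⟩
    0ℚ                                           ≡⟨ sym (ℚP.*-zeroʳ (ι (+ q) * ι (+ q₁))) ⟩
    ι (+ q) * ι (+ q₁) * 0ℚ                      ∎)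

combination≡ι : ∀ (q : ℕ) .{{_ : NonZero q}} {x y} {r s} A B k →
  ι (+ q) * x ≡ ι r → ι (+ q) * y ≡ ι s → A ℤ.* r ℤ.+ B ℤ.* s ≡ + q ℤ.* k →
  ι A * x + ι B * y ≡ ι k
combination≡ι q {x} {y} {r} {s} A B k qx≡r qy≡s Ar+Bs≡qk =
  *-cancelˡ-≡-pos (ι (+ q)) {{ι-pos q}} (begin
    ι (+ q) * (ι A * x + ι B * y)
      ≡⟨ solve 5 (λ c a b x y → c :* (a :* x :+ b :* y) := a :* (c :* x) :+ b :* (c :* y))
           refl (ι (+ q)) (ι A) (ι B) x y ⟩
    ι A * (ι (+ q) * x) + ι B * (ι (+ q) * y) ≡⟨ cong₂ (λ u v → ι A * u + ι B * v) qx≡r qy≡s ⟩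
    ι A * ι r + ι B * ι s             ≡⟨ sym (trans (ι-+ (A ℤ.* r) (B ℤ.* s)) (cong₂ _+_ (ι-* A r) (ι-* B s))) ⟩
    ι (A ℤ.* r ℤ.+ B ℤ.* s)           ≡⟨ cong ι Ar+Bs≡qk ⟩
    ι (+ q ℤ.* k)                     ≡⟨ ι-* (+ q) k ⟩
    ι (+ q) * ι k                     ∎)
  where
  open ≡-Reasoning
  open QS.+-*-Solver

crossNumerator-determinant : ∀ r s q r₁ s₁ q₁ m n →
  crossNumerator s q s₁ q₁ n ℤ.* r ℤ.+ ℤ.- crossNumerator r q r₁ q₁ m ℤ.* s
    ≡ + q ℤ.* (s₁ ℤ.* r ℤ.- r₁ ℤ.* s ℤ.+ + q₁ ℤ.* (m ℤ.* s ℤ.- n ℤ.* r))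
crossNumerator-determinant r s q r₁ s₁ q₁ m n =
  solve 8 (λ r s q r₁ s₁ q₁ m n →
      (q :* s₁ :- q₁ :* s :- q :* q₁ :* n) :* r :+ (:- (q :* r₁ :- q₁ :* r :- q :* q₁ :* m)) :* s
    := q :* (s₁ :* r :- r₁ :* s :+ q₁ :* (m :* s :- n :* r)))
    refl r s (+ q) r₁ s₁ (+ q₁) m n
  where open +-*-Solver

crossNumerators-admissible : ∀ r s q r₁ s₁ q₁ .{{_ : NonZero q}} .{{_ : NonZero q₁}} m n →
  ¬ SameTorusPoint (r / q) (s / q) (r₁ / q₁) (s₁ / q₁) →
  Admissible (r / q) (s / q) (crossNumerator s q s₁ q₁ n) (ℤ.- crossNumerator r q r₁ q₁ m)
crossNumerators-admissible r s q r₁ s₁ q₁ m n distinct =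
  not-both-zero , k , combination≡ι q b (ℤ.- a) k (ι-*-/ r q) (ι-*-/ s q)
    (crossNumerator-determinant r s q r₁ s₁ q₁ m n)
  where
  a b k : ℤ
  a = crossNumerator r q r₁ q₁ m
  b = crossNumerator s q s₁ q₁ n
  k = s₁ ℤ.* r ℤ.- r₁ ℤ.* s ℤ.+ + q₁ ℤ.* (m ℤ.* s ℤ.- n ℤ.* r)
  not-both-zero : ¬ (b ≡ + 0 × ℤ.- a ≡ + 0)
  not-both-zero (b≡0 , -a≡0) = distinct (m , n ,
    crossNumerator≡0⇒r₁/q₁-r/q≡m r q r₁ q₁ m (trans (sym (ℤP.neg-involutive a)) (cong ℤ.-_ -a≡0)) ,
    crossNumerator≡0⇒r₁/q₁-r/q≡m s q s₁ q₁ n b≡0)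

ι-normSq-crossNumerators : ∀ r s q r₁ s₁ q₁ .{{_ : NonZero q}} .{{_ : NonZero q₁}} m n →
  let a = crossNumerator r q r₁ q₁ m; b = crossNumerator s q s₁ q₁ n in
  ι (b ℤ.* b ℤ.+ ℤ.- a ℤ.* ℤ.- a)
    ≡ (sq (r₁ / q₁ - r / q - ι m) + sq (s₁ / q₁ - s / q - ι n)) * sq (ι (+ q) * ι (+ q₁))
ι-normSq-crossNumerators r s q r₁ s₁ q₁ m n = begin
  ι (b ℤ.* b ℤ.+ ℤ.- a ℤ.* ℤ.- a)
    ≡⟨ trans (ι-sumOfSquares b (ℤ.- a)) (cong (λ t → ι b * ι b + t * t) (ι-neg a)) ⟩
  ι b * ι b + (- ι a) * (- ι a)
    ≡⟨ cong₂ (λ u v → u * u + (- v) * (- v)) (ι-crossNumerator s q s₁ q₁ n) (ι-crossNumerator r q r₁ q₁ m) ⟩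
  (C * dy) * (C * dy) + (- (C * dx)) * (- (C * dx))
    ≡⟨ solve 3 (λ c u v → (c :* v) :* (c :* v) :+ (:- (c :* u)) :* (:- (c :* u)) := (u :* u :+ v :* v) :* (c :* c))
         refl C dx dy ⟩
  (sq dx + sq dy) * sq C ∎
  where
  open ≡-Reasoning
  open QS.+-*-Solver
  a b : ℤ
  a = crossNumerator r q r₁ q₁ m
  b = crossNumerator s q s₁ q₁ n
  C dx dy : ℚ
  C = ι (+ q) * ι (+ q₁)
  dx = r₁ / q₁ - r / q - ι m
  dy = s₁ / q₁ - s / q - ι n

lemma3 : (r s : ℤ) (q : ℕ) .{{_ : NonZero q}} → Primitive r s (+ q)
    → (Q : ℚ) → 1ℚ ≤ Q
    → (r₁ s₁ : ℤ) (q₁ : ℕ) .{{_ : NonZero q₁}} → Primitive r₁ s₁ (+ q₁)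
    → ι (+ q₁) ≤ Q
    → ¬ SameTorusPoint (r / q) (s / q) (r₁ / q₁) (s₁ / q₁)
    → (M : ℤ) → IsMinAdmissibleNormSq (r / q) (s / q) M
    → ScaledTorusDistSqAtLeast (r / q) (s / q) (r₁ / q₁) (s₁ / q₁)
        (sq (ι (+ q) * Q)) (ι M)
lemma3 r s q _ Q _ r₁ s₁ q₁ _ q₁≤Q distinct M (_ , M-minimal) m n = begin
  ι M
    ≤⟨ ι-mono-≤ (M-minimal _ _ (crossNumerators-admissible r s q r₁ s₁ q₁ m n distinct)) ⟩
  ι (b ℤ.* b ℤ.+ ℤ.- a ℤ.* ℤ.- a)
    ≡⟨ ι-normSq-crossNumerators r s q r₁ s₁ q₁ m n ⟩
  dist² * sq (ι (+ q) * ι (+ q₁))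
    ≤⟨ ℚP.*-monoˡ-≤-nonNeg dist² {{dist²≥0}} (*-mono-≤-square 0≤qq₁ qq₁≤qQ) ⟩
  dist² * sq (ι (+ q) * Q) ∎
  where
  open ℚP.≤-Reasoning
  instance
    q>0 : ℚ.Positive (ι (+ q))
    q>0 = ι-pos q
  a b : ℤ
  a = crossNumerator r q r₁ q₁ m
  b = crossNumerator s q s₁ q₁ n
  dist² : ℚ
  dist² = sq (r₁ / q₁ - r / q - ι m) + sq (s₁ / q₁ - s / q - ι n)
  dist²≥0 : ℚ.NonNegative dist²
  dist²≥0 = ℚ.nonNegative (ℚP.+-mono-≤ (0≤p*p (r₁ / q₁ - r / q - ι m)) (0≤p*p (s₁ / q₁ - s / q - ι n)))
  0≤qq₁ : 0ℚ ≤ ι (+ q) * ι (+ q₁)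
  0≤qq₁ = ℚP.<⇒≤ (ℚP.positive⁻¹ _ {{ℚP.pos*pos⇒pos (ι (+ q)) (ι (+ q₁)) {{ι-pos q₁}}}})
  qq₁≤qQ : ι (+ q) * ι (+ q₁) ≤ ι (+ q) * Q
  qq₁≤qQ = ℚP.*-monoˡ-≤-nonNeg (ι (+ q)) {{ℚP.pos⇒nonNeg (ι (+ q))}} q₁≤Q
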